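{- For all finite simple graphs $F$ and $G$, $C_{\rm OR}(F\times G)\le \min\{C_{\rm OR}(F), C_{\rm OR}(G)\}$.
   Context: The categorical product $F\times G$ has vertex set $V(F)\times V(G)$, with $(x,u)$ and $(y,v)$ adjacent iff $\{x,y\}\in E(F)$ and $\{u,v\}\in E(G)$. The OR-product $F\cdot G$ has vertex set $V(F)\times V(G)$, with $(f,g)$ and $(f',g')$ adjacent iff $\{f,f'\}\in E(F)$ or $\{g,g'\}\in E(G)$. $G^t$ denotes the $t$-fold OR-product of $G$ with itself and $\omega$ the clique number. The Shannon OR-capacity is $C_{\rm OR}(G)=\lim_{t\to\infty}\sqrt[t]{\omega(G^t)}$. -}

module Defs where

open import Data.Nat using (ℕ; _+_; _*_; _^_; _≤_; _<_)
open import Data.Fin using (Fin)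
open import Data.Vec using (Vec; lookup)
open import Data.List using (List; length)
open import Data.List.Relation.Unary.AllPairs using (AllPairs)
open import Data.Product using (_×_; _,_; Σ; ∃; ∃-syntax)
open import Relation.Nullary using (¬_)
open import Relation.Binary using (Rel; Decidable; Symmetric; Irreflexive)
open import Relation.Binary.PropositionalEquality using (_≡_)

record Graph : Set₁ where
  field
    n      : ℕ
    E      : Fin n → Fin n → Set
    E-dec  : Decidable E
    E-sym  : Symmetric E
    E-irr  : Irreflexive _≡_ E
open Graph public

_×ᴳ_ : (F G : Graph) → (Fin (n F) × Fin (n G)) → (Fin (n F) × Fin (n G)) → Set
(F ×ᴳ G) (x , u) (y , v) = E F x y × E G u v

ORpow : {V : Set} → (V → V → Set) → (t : ℕ) → Vec V t → Vec V t → Set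
ORpow E t x y = ∃[ i ] E (lookup x i) (lookup y i)

-- A clique: a list of pairwise adjacent vertices (pairwise adjacency forces
-- distinctness since the relations used are irreflexive); its size is its length.
Clique : {V : Set} → (V → V → Set) → List V → Set
Clique E C = AllPairs E C

-- "ω(G^t)^{1/t} < p/q", i.e. ω(G^t) · q^t < p^t: every clique of G^t has
-- size ℓ with q^t · ℓ < p^t.
RootBelow : {V : Set} → (V → V → Set) → (p q t : ℕ) → Set
RootBelow {V} E p q t = (C : List (Vec V t)) → Clique (ORpow E t) C → q ^ t * length C < p ^ t

Eventually : (ℕ → Set) → Set
Eventually P = ∃[ T ] ((t : ℕ) → T ≤ t → P t)

-- "C_OR(V,E) < p/q": there is a rational p'/q' < p/q (q' > 0) such that
-- eventually ω(G^t)^{1/t} < p'/q'.  (Valid since the limit C_OR exists.)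
CapLt : {V : Set} → (V → V → Set) → (p q : ℕ) → Set
CapLt E p q = ∃[ p' ] ∃[ q' ] (0 < q' × p' * q < p * q' × Eventually (RootBelow E p' q'))

-- "C_OR(H) ≤ C_OR(K)": every positive rational upper bound (strict) of C_OR(K)
-- is one of C_OR(H).
CapLe : {V W : Set} → (V → V → Set) → (W → W → Set) → Set
CapLe EH EK = (p q : ℕ) → 0 < q → CapLt EK p q → CapLt EH p q

{-# OPTIONS --safe #-}
-- A graph homomorphism f : H → K, applied coordinatewise, is a homomorphism
-- H^t → K^t of OR-powers, so it sends cliques of H^t to cliques of K^t of the
-- same size. Hence ω(H^t) ≤ ω(K^t) for every t and C_OR(H) ≤ C_OR(K). Both
-- projections F × G → F and F × G → G are homomorphisms.
module Submission where

open import Defs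
open import Data.Nat using (_*_; _^_; _<_)
open import Data.Product using (_×_; _,_; proj₁; proj₂)
import Data.Vec as Vec
open import Data.Vec.Properties using (lookup-map)
open import Data.List using (map)
open import Data.List.Properties using (length-map)
import Data.List.Relation.Unary.AllPairs as AllPairs
open import Data.List.Relation.Unary.AllPairs.Properties using (map⁺)
open import Relation.Binary.PropositionalEquality using (subst; subst₂; sym)

record Homomorphism {V W : Set} (EH : V → V → Set) (EK : W → W → Set) (f : V → W) : Set where
  constructor homomorphism
  field
    preserves-edge : ∀ {a b} → EH a b → EK (f a) (f b)
open Homomorphism

private variable
  V W : Set
  EH : V → V → Set
  EK : W → W → Set
  f : V → W

ORpow-homomorphism : Homomorphism EH EK f → ∀ t → Homomorphism (ORpow EH t) (ORpow EK t) (Vec.map f)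
preserves-edge (ORpow-homomorphism {EK = EK} {f = f} hom t) {x} {y} (i , e) =
  i , subst₂ EK (sym (lookup-map i f x)) (sym (lookup-map i f y)) (preserves-edge hom e)

Clique-map : Homomorphism EH EK f → ∀ {C} → Clique EH C → Clique EK (map f C)
Clique-map hom cl = map⁺ (AllPairs.map (preserves-edge hom) cl)

RootBelow-homomorphism : Homomorphism EH EK f → ∀ p q t → RootBelow EK p q t → RootBelow EH p q t
RootBelow-homomorphism {f = f} hom p q t below C cl =
  subst (λ k → q ^ t * k < p ^ t) (length-map (Vec.map f) C)
        (below (map (Vec.map f) C) (Clique-map (ORpow-homomorphism hom t) cl))

CapLe-homomorphism : Homomorphism EH EK f → CapLe EH EK
CapLe-homomorphism hom p q _ (p′ , q′ , q′>0 , p′/q′<p/q , T , below) =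
  p′ , q′ , q′>0 , p′/q′<p/q , T ,
  λ t T≤t → RootBelow-homomorphism hom p′ q′ t (below t T≤t)

proj₁-homomorphism : (F G : Graph) → Homomorphism (F ×ᴳ G) (E F) proj₁
proj₁-homomorphism F G = homomorphism proj₁

proj₂-homomorphism : (F G : Graph) → Homomorphism (F ×ᴳ G) (E G) proj₂
proj₂-homomorphism F G = homomorphism proj₂

corollary4 : (F G : Graph) → CapLe (F ×ᴳ G) (E F) × CapLe (F ×ᴳ G) (E G)
corollary4 F G = CapLe-homomorphism (proj₁-homomorphism F G)
               , CapLe-homomorphism (proj₂-homomorphism F G)
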